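{- Let $G$ be a complete multipartite graph with parts $V_1,\dots,V_r$. If $|V_i|$ is odd for at least two values of $i$, then $\nu(G)=\eta(G)=0$.
   Context: A complete multipartite graph with parts $V_1,\dots,V_r$ has vertex set $V_1\cup\cdots\cup V_r$ (disjoint) with $u,v$ adjacent iff they lie in different parts. For an $n$-vertex digraph $D$, a descent of a bijection $\sigma:V(D)\to[n]$ is an arc $u\to v$ with $\sigma(u)>\sigma(v)$ and $A_D(t)=\sum_\sigma t^{\mathrm{des}_D(\sigma)}$ with $\mathrm{des}_D(\sigma)$ the number of descents; $\nu(G):=|A_D(-1)|$ for any orientation $D$ of $G$ (independent of orientation). An ordering $(\pi_1,\dots,\pi_n)$ of $V(G)$ is an even sequence if each $G[\{\pi_1,\dots,\pi_i\}]$ has an even number of edges; $\eta(G)$ is their number. -}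

module Defs where

open import Data.Nat using (ℕ; zero; suc; _<ᵇ_; _%_)
open import Data.Bool using (Bool; true; false; _∧_; _xor_; not)
open import Data.Fin using (Fin; zero; suc; toℕ; _≟_)
open import Data.Fin.Properties using (all?; any?)
open import Data.List using (List; []; _∷_; map; concatMap; filter; filterᵇ; length; allFin; foldr)
open import Data.Nat.ListAction using (sum)
open import Data.Product using (_×_; ∃; _,_)
open import Data.Integer using (ℤ; -1ℤ; _^_)
import Data.Integer as ℤ
open import Relation.Binary.PropositionalEquality using (_≡_)
open import Relation.Nullary using (Dec; ¬_)
open import Relation.Nullary.Decidable using (_×-dec_; _→-dec_; ⌊_⌋)

allFuns : (n m : ℕ) → List (Fin n → Fin m)
allFuns zero    m = (λ ()) ∷ []
allFuns (suc n) m =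
  concatMap (λ f → map (λ x → λ { zero → x ; (suc i) → f i }) (allFin m)) (allFuns n m)

Injective : {n m : ℕ} → (Fin n → Fin m) → Set
Injective f = ∀ u v → f u ≡ f v → u ≡ v

Surjective : {n m : ℕ} → (Fin n → Fin m) → Set
Surjective {n} f = ∀ y → ∃ λ x → f x ≡ y

Bijective : {n m : ℕ} → (Fin n → Fin m) → Set
Bijective f = Injective f × Surjective f

bijective? : {n m : ℕ} → (f : Fin n → Fin m) → Dec (Bijective f)
bijective? f =
  all? (λ u → all? (λ v → (f u ≟ f v) →-dec (u ≟ v)))
  ×-dec all? (λ y → any? (λ x → f x ≟ y))

-- All bijections Fin n → Fin n (the bijections V(D) → [n], with V = Fin n).
allBijections : (n : ℕ) → List (Fin n → Fin n)
allBijections n = filter bijective? (allFuns n n)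

countPairs : (n : ℕ) → (Fin n → Fin n → Bool) → ℕ
countPairs n p = sum (map (λ u → length (filterᵇ (λ v → p u v) (allFin n))) (allFin n))

-- A (simple) graph on vertex set Fin n: symmetric irreflexive boolean adjacency.
-- Complete multipartite graph with parts V_i = { v | part v ≡ i }, i ∈ Fin r.
completeMultipartite : {n r : ℕ} → (Fin n → Fin r) → Fin n → Fin n → Bool
completeMultipartite part u v = not ⌊ part u ≟ part v ⌋

partSize : {n r : ℕ} → (Fin n → Fin r) → Fin r → ℕ
partSize {n} part i = length (filterᵇ (λ v → ⌊ part v ≟ i ⌋) (allFin n))

IsOrientation : {n : ℕ} → (Fin n → Fin n → Bool) → (Fin n → Fin n → Bool) → Set
IsOrientation adj D =
  ∀ u v → (D u v ≡ true → adj u v ≡ true) × (adj u v ≡ true → (D u v xor D v u) ≡ true)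

des : {n : ℕ} → (Fin n → Fin n → Bool) → (Fin n → Fin n) → ℕ
des {n} D σ = countPairs n (λ u v → D u v ∧ (toℕ (σ v) <ᵇ toℕ (σ u)))

A-at-minus1 : {n : ℕ} → (Fin n → Fin n → Bool) → ℤ
A-at-minus1 {n} D = foldr ℤ._+_ (ℤ.+ 0) (map (λ σ → -1ℤ ^ des D σ) (allBijections n))

-- ν(G) computed via the orientation D: |A_D(-1)|.
ν : {n : ℕ} → (Fin n → Fin n → Bool) → ℕ
ν D = ℤ.∣ A-at-minus1 D ∣

-- Number of edges of G[{π_1,…,π_i}] (π as a bijection Fin n → V, 0-indexed positions).
prefixEdges : {n : ℕ} → (Fin n → Fin n → Bool) → (Fin n → Fin n) → ℕ → ℕ
prefixEdges {n} adj π i =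
  countPairs n (λ j k → (toℕ j <ᵇ toℕ k) ∧ (toℕ k <ᵇ i) ∧ adj (π j) (π k))

isEvenSequence : {n : ℕ} → (Fin n → Fin n → Bool) → (Fin n → Fin n) → Bool
isEvenSequence {n} adj π =
  ⌊ all? (λ (i : Fin (suc n)) → prefixEdges adj π (toℕ i) % 2 Data.Nat.≟ 0) ⌋

η : {n : ℕ} → (Fin n → Fin n → Bool) → ℕ
η {n} adj = length (filterᵇ (isEvenSequence adj) (allBijections n))

module Submission where

-- Everything hinges on the vertices an ordering puts at positions 2k and 2k+1. Call an ordering
-- paired if every such pair lies inside one part. Each part of a paired ordering has even size,
-- except possibly the part of the last vertex when n is odd; so with two odd parts no ordering is
-- paired.
--
-- η: in an even sequence every vertex has an even number of earlier neighbours. In a complete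
-- multipartite graph the vertex at position 2k+1 then has an odd number of earlier vertices in its
-- own part, and if the pairs before 2k are already matched this forces the vertex at 2k into that
-- part. By induction on k every even sequence is paired, so there are none.
--
-- ν: for a non-paired bijection let k be the first split pair and exchange the labels 2k and 2k+1.
-- This keeps k, and changes the set of descents only at the edge joining the two swapped vertices,
-- so it is a sign-reversing involution and A_D(-1) = 0. Formally, the signed sum over orderings with
-- no split pair before k does not depend on k, because its part with first split pair k cancels.

open import Defs
open import Data.Nat using (ℕ; _%_)
open import Data.Fin using (Fin)
open import Data.Bool using (Bool)
open import Data.Product using (_×_; ∃)
open import Relation.Binary.PropositionalEquality using (_≡_)
open import Relation.Nullary using (¬_)

import Algebra.Properties.CommutativeMonoid.Sum as CommutativeMonoidSum
open import Data.Bool using (true; false; not; _∧_; _xor_; if_then_else_; T)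
open import Data.Bool.Properties
  using (∧-conicalˡ; ∧-conicalʳ; ∧-zeroʳ; ∧-identityʳ; not-involutive; not-distribˡ-xor; not-distribʳ-xor; xor-same)
open import Data.Empty using (⊥; ⊥-elim)
open import Data.Fin using (zero; suc; toℕ; fromℕ<) renaming (_≟_ to _≟ᶠ_)
open import Data.Fin.Permutation using (Permutation; permutation; _⟨$⟩ʳ_)
import Data.Fin.Permutation as Perm
import Data.Fin.Permutation.Components as PC
open import Data.Fin.Properties using (toℕ<n; toℕ-fromℕ<; toℕ-injective; any?)
open import Data.Integer using (ℤ; 0ℤ; 1ℤ; -1ℤ; _^_) renaming (_+_ to _+ℤ_)
import Data.Integer as ℤ
import Data.Integer.Properties as ℤP
open import Algebra.Properties.CommutativeSemigroup ℤP.+-commutativeSemigroup using (interchange)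
open import Data.List using (List; []; _∷_; _++_; map; concatMap; foldr; length; filter; filterᵇ; tabulate; allFin)
open import Data.List.Properties using (filter-none; map-++; map-∘)
import Data.List.Relation.Unary.All as All
open import Data.List.Relation.Unary.All.Properties using (all-filter)
open import Data.Nat using (zero; suc; _+_; _<_; _≤_; _<ᵇ_; s≤s) renaming (_≟_ to _≟ℕ_)
import Data.Nat.ListAction as ListSum
open import Data.Nat.Properties
  using ( +-0-commutativeMonoid; +-assoc; +-comm; +-identityʳ; +-suc; +-mono-≤; 1+n≢n; n<1+n; m≤m+n
        ; ≤-refl; ≤-reflexive; ≤-trans; <-irrefl; <-trans; ≤-<-trans; <⇒≤; m<n⇒m<1+n; m≤n⇒m<n∨m≡n; _<?_)
open import Data.Product using (_,_; proj₁; proj₂)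
open import Data.Sum using (_⊎_; inj₁; inj₂)
open import Data.Vec.Functional using () renaming (_∷_ to _∷ᶠ_)
open import Function using (_∘_; id)
open import Function.Bundles using (mk⇔)
open import Relation.Binary.PropositionalEquality
  using (_≢_; refl; sym; trans; cong; cong₂; subst; module ≡-Reasoning)
open import Relation.Nullary using (Dec; yes; no; does; contradiction; ¬?; _×-dec_)
open import Relation.Nullary.Decidable using (⌊_⌋; T?; toWitness; ⌊⌋-map′; dec-true; dec-false; does-⇔)

module ℤΣ = CommutativeMonoidSum ℤP.+-0-commutativeMonoid

open CommutativeMonoidSum +-0-commutativeMonoid
  using (sum; sum-cong-≗; sum-replicate-zero; ∑-distrib-+; ∑-comm; ∑-permute)

𝟙 : Bool → ℕ
𝟙 true  = 1
𝟙 false = 0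

𝟙-∧ : ∀ x y → 𝟙 (x ∧ y) ≡ (if x then 𝟙 y else 0)
𝟙-∧ true  y = refl
𝟙-∧ false y = refl

length-filterᵇ-tabulate : ∀ {a} {A : Set a} {n} (P : A → Bool) (f : Fin n → A) →
  length (filterᵇ P (tabulate f)) ≡ sum (𝟙 ∘ P ∘ f)
length-filterᵇ-tabulate {n = zero}  P f = refl
length-filterᵇ-tabulate {n = suc n} P f with P (f zero)
... | true  = cong suc (length-filterᵇ-tabulate P (f ∘ suc))
... | false = length-filterᵇ-tabulate P (f ∘ suc)

sum-map-tabulate : ∀ {a} {A : Set a} {n} (F : A → ℕ) (f : Fin n → A) →
  ListSum.sum (map F (tabulate f)) ≡ sum (F ∘ f)
sum-map-tabulate {n = zero}  F f = refl
sum-map-tabulate {n = suc n} F f = cong (F (f zero) +_) (sum-map-tabulate F (f ∘ suc))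

countPairs≡∑∑ : ∀ n (p : Fin n → Fin n → Bool) → countPairs n p ≡ sum (λ u → sum (λ v → 𝟙 (p u v)))
countPairs≡∑∑ n p =
  trans (sum-map-tabulate (λ u → length (filterᵇ (p u) (tabulate id))) id)
        (sum-cong-≗ (λ u → length-filterᵇ-tabulate (p u) id))

sum-at : ∀ {n} (a : Fin n) (f : Fin n → ℕ) → sum (λ j → if ⌊ j ≟ᶠ a ⌋ then f j else 0) ≡ f a
sum-at {suc n} zero    f = trans (cong (f zero +_) (sum-replicate-zero n)) (+-identityʳ _)
sum-at {suc n} (suc a) f =
  trans (sum-cong-≗ λ j → cong (if_then f (suc j) else 0) (⌊⌋-map′ _ _ (j ≟ᶠ a))) (sum-at a (f ∘ suc))

<⇒<ᵇ≡true : ∀ {m n} → m < n → (m <ᵇ n) ≡ true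
<⇒<ᵇ≡true {zero}  (s≤s _)   = refl
<⇒<ᵇ≡true {suc m} (s≤s m<n) = <⇒<ᵇ≡true m<n

≤⇒<ᵇ≡false : ∀ {m n} → n ≤ m → (m <ᵇ n) ≡ false
≤⇒<ᵇ≡false {m}     {zero}  _         = refl
≤⇒<ᵇ≡false {suc m} {suc n} (s≤s n≤m) = ≤⇒<ᵇ≡false n≤m

<ᵇ-suc : ∀ {m n} → m ≢ n → (m <ᵇ suc n) ≡ (m <ᵇ n)
<ᵇ-suc {zero}  {zero}  m≢n = ⊥-elim (m≢n refl)
<ᵇ-suc {zero}  {suc n} _   = refl
<ᵇ-suc {suc m} {zero}  _   = refl
<ᵇ-suc {suc m} {suc n} m≢n = <ᵇ-suc (m≢n ∘ cong suc)

<ᵇ-irrefl : ∀ m → (m <ᵇ m) ≡ false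
<ᵇ-irrefl m = ≤⇒<ᵇ≡false (≤-refl {m})

suc-<ᵇ : ∀ {m n} → n ≢ suc m → (suc m <ᵇ n) ≡ (m <ᵇ n)
suc-<ᵇ {m} {zero}  _   = refl
suc-<ᵇ {m} {suc n} n≢1+m = sym (<ᵇ-suc (λ m≡n → n≢1+m (cong suc (sym m≡n))))

prefixSum : ∀ {n} → (Fin n → ℕ) → ℕ → ℕ
prefixSum f i = sum (λ j → if toℕ j <ᵇ i then f j else 0)

prefixSum-cong : ∀ {n} {f g : Fin n → ℕ} → (∀ j → f j ≡ g j) → ∀ i → prefixSum f i ≡ prefixSum g i
prefixSum-cong f≗g i = sum-cong-≗ λ j → cong (if toℕ j <ᵇ i then_else 0) (f≗g j)

prefixSum-+ : ∀ {n} (f g : Fin n → ℕ) i → prefixSum f i + prefixSum g i ≡ prefixSum (λ j → f j + g j) i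
prefixSum-+ {n} f g i = trans (sym (∑-distrib-+ {n} _ _)) (sum-cong-≗ {n} λ j → if-+ (toℕ j <ᵇ i))
  where
  if-+ : ∀ b {x y} → (if b then x else 0) + (if b then y else 0) ≡ (if b then x + y else 0)
  if-+ true  = refl
  if-+ false = refl

prefixSum-suc : ∀ {n} (f : Fin n → ℕ) (a : Fin n) → prefixSum f (suc (toℕ a)) ≡ prefixSum f (toℕ a) + f a
prefixSum-suc {n} f a = begin
    prefixSum f (suc (toℕ a))
  ≡⟨ sum-cong-≗ split ⟩
    sum (λ j → (if toℕ j <ᵇ toℕ a then f j else 0) + (if ⌊ j ≟ᶠ a ⌋ then f j else 0))
  ≡⟨ ∑-distrib-+ {n} _ _ ⟩
    prefixSum f (toℕ a) + sum (λ j → if ⌊ j ≟ᶠ a ⌋ then f j else 0)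
  ≡⟨ cong (prefixSum f (toℕ a) +_) (sum-at a f) ⟩
    prefixSum f (toℕ a) + f a ∎
  where
  open ≡-Reasoning
  split : ∀ j → (if toℕ j <ᵇ suc (toℕ a) then f j else 0)
              ≡ (if toℕ j <ᵇ toℕ a then f j else 0) + (if ⌊ j ≟ᶠ a ⌋ then f j else 0)
  split j with j ≟ᶠ a
  ... | yes refl rewrite <⇒<ᵇ≡true (n<1+n (toℕ a)) | <ᵇ-irrefl (toℕ a) = refl
  ... | no j≢a rewrite <ᵇ-suc (j≢a ∘ toℕ-injective) = sym (+-identityʳ _)

prefixSum-full : ∀ {n} (f : Fin n → ℕ) → prefixSum f n ≡ sum f
prefixSum-full f = sum-cong-≗ λ j → cong (if_then f j else 0) (<⇒<ᵇ≡true (toℕ<n j))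

prefixSum-ones : ∀ {n} i → i ≤ n → prefixSum {n} (λ _ → 1) i ≡ i
prefixSum-ones {zero}  zero    _         = refl
prefixSum-ones {suc n} zero    _         = sum-replicate-zero n
prefixSum-ones {suc n} (suc i) (s≤s i≤n) = cong suc (prefixSum-ones i i≤n)

parity : ℕ → Bool
parity zero    = false
parity (suc n) = not (parity n)

parity-+ : ∀ m n → parity (m + n) ≡ parity m xor parity n
parity-+ zero    n = refl
parity-+ (suc m) n = trans (cong not (parity-+ m n)) (not-distribˡ-xor (parity m) (parity n))

parity-double : ∀ m → parity (m + m) ≡ false
parity-double m = trans (parity-+ m m) (xor-same (parity m))

parity-𝟙 : ∀ b → parity (𝟙 b) ≡ b
parity-𝟙 true  = refl
parity-𝟙 false = refl

parity-+-𝟙 : ∀ m b → parity (m + 𝟙 b) ≡ parity m xor b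
parity-+-𝟙 m b = trans (parity-+ m (𝟙 b)) (cong (parity m xor_) (parity-𝟙 b))

%2≡𝟙-parity : ∀ n → n % 2 ≡ 𝟙 (parity n)
%2≡𝟙-parity zero          = refl
%2≡𝟙-parity (suc zero)    = refl
%2≡𝟙-parity (suc (suc n)) = trans (%2≡𝟙-parity n) (cong 𝟙 (sym (not-involutive (parity n))))

odd⇒parity : ∀ n → n % 2 ≡ 1 → parity n ≡ true
odd⇒parity n n%2≡1 with parity n | %2≡𝟙-parity n
... | true  | _     = refl
... | false | n%2≡0 with trans (sym n%2≡1) n%2≡0
...   | ()

even⇒parity : ∀ n → n % 2 ≡ 0 → parity n ≡ false
even⇒parity n n%2≡0 with parity n | %2≡𝟙-parity n
... | false | _     = refl
... | true  | n%2≡1 with trans (sym n%2≡0) n%2≡1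
...   | ()

even-or-odd : ∀ n → ∃ λ m → n ≡ m + m ⊎ n ≡ suc (m + m)
even-or-odd zero = 0 , inj₁ refl
even-or-odd (suc n) with even-or-odd n
... | m , inj₁ n≡2m   = m , inj₂ (cong suc n≡2m)
... | m , inj₂ n≡2m+1 = suc m , inj₁ (trans (cong suc n≡2m+1) (cong suc (sym (+-suc m m))))

module _ {n r : ℕ} (w : Fin n → Fin r) where

  occurrences : Fin r → ℕ → ℕ
  occurrences p = prefixSum (λ j → 𝟙 ⌊ w j ≟ᶠ p ⌋)

  PairedBelow : ℕ → Set
  PairedBelow m = ∀ k (a b : Fin n) → k < m → toℕ a ≡ k + k → toℕ b ≡ suc (k + k) → w a ≡ w b

  Paired : Set
  Paired = ∀ k (a b : Fin n) → toℕ a ≡ k + k → toℕ b ≡ suc (k + k) → w a ≡ w b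

  occurrences-suc : ∀ p (a : Fin n) {i} → toℕ a ≡ i → occurrences p (suc i) ≡ occurrences p i + 𝟙 ⌊ w a ≟ᶠ p ⌋
  occurrences-suc p a refl = prefixSum-suc _ a

  even-occurrences : ∀ m → m + m ≤ n → PairedBelow m → ∀ p → parity (occurrences p (m + m)) ≡ false
  even-occurrences zero    _      _      p = cong parity (sum-replicate-zero n)
  even-occurrences (suc m) 2m+2≤n paired p = begin
      parity (occurrences p (suc m + suc m))
    ≡⟨ cong (λ i → parity (occurrences p (suc i))) (+-suc m m) ⟩
      parity (occurrences p (suc (suc (m + m))))
    ≡⟨ cong parity (occurrences-suc p b (toℕ-fromℕ< 2m+1<n)) ⟩
      parity (occurrences p (suc (m + m)) + 𝟙 ⌊ w b ≟ᶠ p ⌋)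
    ≡⟨ cong (λ k → parity (k + 𝟙 ⌊ w b ≟ᶠ p ⌋)) (occurrences-suc p a (toℕ-fromℕ< 2m<n)) ⟩
      parity (occurrences p (m + m) + 𝟙 ⌊ w a ≟ᶠ p ⌋ + 𝟙 ⌊ w b ≟ᶠ p ⌋)
    ≡⟨ cong (λ c → parity (occurrences p (m + m) + 𝟙 ⌊ w a ≟ᶠ p ⌋ + 𝟙 ⌊ c ≟ᶠ p ⌋)) (sym wa≡wb) ⟩
      parity (occurrences p (m + m) + 𝟙 ⌊ w a ≟ᶠ p ⌋ + 𝟙 ⌊ w a ≟ᶠ p ⌋)
    ≡⟨ cong parity (+-assoc (occurrences p (m + m)) _ _) ⟩
      parity (occurrences p (m + m) + (𝟙 ⌊ w a ≟ᶠ p ⌋ + 𝟙 ⌊ w a ≟ᶠ p ⌋))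
    ≡⟨ parity-+ (occurrences p (m + m)) _ ⟩
      parity (occurrences p (m + m)) xor parity (𝟙 ⌊ w a ≟ᶠ p ⌋ + 𝟙 ⌊ w a ≟ᶠ p ⌋)
    ≡⟨ cong₂ _xor_ (even-occurrences m (<⇒≤ 2m<n) (λ k a b k<m → paired k a b (m<n⇒m<1+n k<m)) p)
                   (parity-double (𝟙 ⌊ w a ≟ᶠ p ⌋)) ⟩
      false ∎
    where
    open ≡-Reasoning
    2m+1<n : suc (m + m) < n
    2m+1<n = subst (λ k → suc k ≤ n) (+-suc m m) 2m+2≤n
    2m<n : m + m < n
    2m<n = <⇒≤ 2m+1<n
    a b : Fin n
    a = fromℕ< 2m<n
    b = fromℕ< 2m+1<n
    wa≡wb : w a ≡ w b
    wa≡wb = paired m a b (n<1+n m) (toℕ-fromℕ< 2m<n) (toℕ-fromℕ< 2m+1<n)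

  -- With the prefix of length 2k balanced, the parity of the prefix of length 2k+1 detects the letter at 2k.
  odd-occurrences⇒letter : ∀ k (a : Fin n) → toℕ a ≡ k + k → PairedBelow k →
    ∀ p → parity (occurrences p (suc (k + k))) ≡ true → w a ≡ p
  odd-occurrences⇒letter k a a≡2k paired p odd = letter (begin
      ⌊ w a ≟ᶠ p ⌋
    ≡⟨ cong (_xor ⌊ w a ≟ᶠ p ⌋) (even-occurrences k 2k≤n paired p) ⟨
      parity (occurrences p (k + k)) xor ⌊ w a ≟ᶠ p ⌋
    ≡⟨ parity-+-𝟙 (occurrences p (k + k)) _ ⟨
      parity (occurrences p (k + k) + 𝟙 ⌊ w a ≟ᶠ p ⌋)
    ≡⟨ cong parity (occurrences-suc p a a≡2k) ⟨
      parity (occurrences p (suc (k + k)))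
    ≡⟨ odd ⟩
      true ∎)
    where
    open ≡-Reasoning
    2k≤n : k + k ≤ n
    2k≤n = <⇒≤ (subst (_< n) a≡2k (toℕ<n a))
    letter : ⌊ w a ≟ᶠ p ⌋ ≡ true → w a ≡ p
    letter wa≟p with w a ≟ᶠ p
    ... | yes wa≡p = wa≡p
    letter () | no _

  paired⇒odd-occurrences-unique : Paired → ∀ p q → p ≢ q →
    parity (occurrences p n) ≡ true → parity (occurrences q n) ≡ true → ⊥
  paired⇒odd-occurrences-unique paired p q p≢q p-odd q-odd with even-or-odd n
  ... | m , inj₁ n≡2m = contradiction (trans (sym p-even) p-odd) λ ()
    where
    p-even : parity (occurrences p n) ≡ false
    p-even = subst (λ i → parity (occurrences p i) ≡ false) (sym n≡2m)
               (even-occurrences m (≤-reflexive (sym n≡2m)) (λ k a b _ → paired k a b) p)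
  paired⇒odd-occurrences-unique paired p q p≢q p-odd q-odd | m , inj₂ n≡2m+1 =
    p≢q (trans (sym (letter≡ p p-odd)) (letter≡ q q-odd))
    where
    2m<n : m + m < n
    2m<n = ≤-reflexive (sym n≡2m+1)
    letter≡ : ∀ p → parity (occurrences p n) ≡ true → w (fromℕ< 2m<n) ≡ p
    letter≡ p odd = odd-occurrences⇒letter m (fromℕ< 2m<n) (toℕ-fromℕ< 2m<n) (λ k a b _ → paired k a b) p
                      (subst (λ i → parity (occurrences p i) ≡ true) n≡2m+1 odd)

module _ {n : ℕ} {π : Fin n → Fin n} (bij : Bijective π) where

  inverse : Fin n → Fin n
  inverse y = proj₁ (proj₂ bij y)

  inverseʳ : ∀ y → π (inverse y) ≡ y
  inverseʳ y = proj₂ (proj₂ bij y)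

  inverseˡ : ∀ x → inverse (π x) ≡ x
  inverseˡ x = proj₁ bij (inverse (π x)) x (inverseʳ (π x))

  inverse-bijective : Bijective inverse
  inverse-bijective = (λ u v eq → trans (sym (inverseʳ u)) (trans (cong π eq) (inverseʳ v))) , λ y → π y , inverseˡ y

  toPermutation : Permutation n n
  toPermutation = permutation π inverse inverseʳ inverseˡ

partSize≡occurrences : ∀ {n r} (part : Fin n → Fin r) {π : Fin n → Fin n} → Bijective π →
  ∀ p → partSize part p ≡ occurrences (part ∘ π) p n
partSize≡occurrences {n} part {π} bij p = begin
    partSize part p
  ≡⟨ length-filterᵇ-tabulate (λ v → ⌊ part v ≟ᶠ p ⌋) id ⟩
    sum (λ v → 𝟙 ⌊ part v ≟ᶠ p ⌋)
  ≡⟨ ∑-permute (λ v → 𝟙 ⌊ part v ≟ᶠ p ⌋) (toPermutation bij) ⟩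
    sum (λ j → 𝟙 ⌊ part (π j) ≟ᶠ p ⌋)
  ≡⟨ prefixSum-full (λ j → 𝟙 ⌊ part (π j) ≟ᶠ p ⌋) ⟨
    occurrences (part ∘ π) p n ∎
  where open ≡-Reasoning

TwoOddParts : ∀ {n r} → (Fin n → Fin r) → Set
TwoOddParts part = ∃ λ i → ∃ λ j → ¬ (i ≡ j) × (partSize part i % 2 ≡ 1) × (partSize part j % 2 ≡ 1)

twoOddParts⇒¬paired : ∀ {n r} (part : Fin n → Fin r) {π : Fin n → Fin n} → TwoOddParts part →
  Bijective π → ¬ Paired (part ∘ π)
twoOddParts⇒¬paired {n} part {π} (i , j , i≢j , i-odd , j-odd) bij paired =
  paired⇒odd-occurrences-unique (part ∘ π) paired i j i≢j (odd-part i i-odd) (odd-part j j-odd)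
  where
  odd-part : ∀ p → partSize part p % 2 ≡ 1 → parity (occurrences (part ∘ π) p n) ≡ true
  odd-part p odd = subst (λ s → parity s ≡ true) (partSize≡occurrences part bij p) (odd⇒parity (partSize part p) odd)

backDegree : ∀ {n} → (Fin n → Fin n → Bool) → (Fin n → Fin n) → Fin n → ℕ
backDegree adj π c = prefixSum (λ j → 𝟙 (adj (π j) (π c))) (toℕ c)

prefixEdges≡prefixSum-backDegree : ∀ {n} (adj : Fin n → Fin n → Bool) (π : Fin n → Fin n) i →
  prefixEdges adj π i ≡ prefixSum (backDegree adj π) i
prefixEdges≡prefixSum-backDegree {n} adj π i =
  trans (countPairs≡∑∑ n _) (trans (∑-comm {n} {n} _) (sum-cong-≗ column))
  where
  column : ∀ k → sum (λ j → 𝟙 ((toℕ j <ᵇ toℕ k) ∧ (toℕ k <ᵇ i) ∧ adj (π j) (π k)))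
               ≡ (if toℕ k <ᵇ i then backDegree adj π k else 0)
  column k with toℕ k <ᵇ i
  ... | true  = sum-cong-≗ {n} λ j → 𝟙-∧ (toℕ j <ᵇ toℕ k) (adj (π j) (π k))
  ... | false = trans (sum-cong-≗ {n} λ j → cong 𝟙 (∧-zeroʳ (toℕ j <ᵇ toℕ k))) (sum-replicate-zero n)

evenSequence⇒even-backDegree : ∀ {n} (adj : Fin n → Fin n → Bool) (π : Fin n → Fin n) →
  T (isEvenSequence adj π) → ∀ c → parity (backDegree adj π c) ≡ false
evenSequence⇒even-backDegree {n} adj π even-seq c = begin
    parity (backDegree adj π c)
  ≡⟨ cong (_xor parity (backDegree adj π c)) (even-prefix (toℕ c) (<⇒≤ (toℕ<n c))) ⟨
    parity (prefixSum (backDegree adj π) (toℕ c)) xor parity (backDegree adj π c)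
  ≡⟨ parity-+ (prefixSum (backDegree adj π) (toℕ c)) _ ⟨
    parity (prefixSum (backDegree adj π) (toℕ c) + backDegree adj π c)
  ≡⟨ cong parity (prefixSum-suc (backDegree adj π) c) ⟨
    parity (prefixSum (backDegree adj π) (suc (toℕ c)))
  ≡⟨ even-prefix (suc (toℕ c)) (toℕ<n c) ⟩
    false ∎
  where
  open ≡-Reasoning
  even-prefix : ∀ i → i ≤ n → parity (prefixSum (backDegree adj π) i) ≡ false
  even-prefix i i≤n = even⇒parity (prefixSum (backDegree adj π) i)
    (subst (λ e → e % 2 ≡ 0) edges≡ (toWitness even-seq (fromℕ< (s≤s i≤n))))
    where
    edges≡ : prefixEdges adj π (toℕ (fromℕ< (s≤s i≤n))) ≡ prefixSum (backDegree adj π) i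
    edges≡ = trans (cong (prefixEdges adj π) (toℕ-fromℕ< (s≤s i≤n))) (prefixEdges≡prefixSum-backDegree adj π i)

-- In a complete multipartite graph the earlier vertices are either earlier neighbours or in the same part.
backDegree-multipartite : ∀ {n r} (part : Fin n → Fin r) (π : Fin n → Fin n) c →
  backDegree (completeMultipartite part) π c + occurrences (part ∘ π) (part (π c)) (toℕ c) ≡ toℕ c
backDegree-multipartite part π c =
  trans (prefixSum-+ (λ j → 𝟙 (completeMultipartite part (π j) (π c))) (λ j → 𝟙 ⌊ part (π j) ≟ᶠ part (π c) ⌋)
                     (toℕ c))
        (trans (prefixSum-cong (λ j → 𝟙-not+𝟙 ⌊ part (π j) ≟ᶠ part (π c) ⌋) (toℕ c))
               (prefixSum-ones (toℕ c) (<⇒≤ (toℕ<n c))))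
  where
  𝟙-not+𝟙 : ∀ b → 𝟙 (not b) + 𝟙 b ≡ 1
  𝟙-not+𝟙 true  = refl
  𝟙-not+𝟙 false = refl

evenBackDegree⇒paired : ∀ {n r} (part : Fin n → Fin r) (π : Fin n → Fin n) →
  (∀ c → parity (backDegree (completeMultipartite part) π c) ≡ false) → Paired (part ∘ π)
evenBackDegree⇒paired {n} {r} part π even k a b = pairedBelow (suc k) k a b (n<1+n k)
  where
  w : Fin n → Fin r
  w = part ∘ π
  pair : ∀ k → PairedBelow w k → ∀ (a b : Fin n) → toℕ a ≡ k + k → toℕ b ≡ suc (k + k) → w a ≡ w b
  pair k below a b a≡2k b≡2k+1 = odd-occurrences⇒letter w k a a≡2k below (w b) (begin
      parity (occurrences w (w b) (suc (k + k)))
    ≡⟨ cong (λ i → parity (occurrences w (w b) i)) b≡2k+1 ⟨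
      parity (occurrences w (w b) (toℕ b))
    ≡⟨ cong (_xor parity (occurrences w (w b) (toℕ b))) (even b) ⟨
      parity (backDegree (completeMultipartite part) π b) xor parity (occurrences w (w b) (toℕ b))
    ≡⟨ parity-+ (backDegree (completeMultipartite part) π b) _ ⟨
      parity (backDegree (completeMultipartite part) π b + occurrences w (w b) (toℕ b))
    ≡⟨ cong parity (trans (backDegree-multipartite part π b) b≡2k+1) ⟩
      parity (suc (k + k))
    ≡⟨ cong not (parity-double k) ⟩
      true ∎)
    where open ≡-Reasoning
  pairedBelow : ∀ m → PairedBelow w m
  pairedBelow (suc m) k a b (s≤s k≤m) with m≤n⇒m<n∨m≡n k≤m
  ... | inj₁ k<m  = pairedBelow m k a b k<m
  ... | inj₂ refl = pair k (pairedBelow k) a b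

η≡0 : ∀ {n r} (part : Fin n → Fin r) → TwoOddParts part → η (completeMultipartite part) ≡ 0
η≡0 {n} part odd = cong length (filter-none (T? ∘ isEvenSequence (completeMultipartite part))
  (All.map (λ {π} bij even-seq → twoOddParts⇒¬paired part odd bij
              (evenBackDegree⇒paired part π (evenSequence⇒even-backDegree (completeMultipartite part) π even-seq)))
           (all-filter bijective? (allFuns n n))))

sumℤ : List ℤ → ℤ
sumℤ = foldr _+ℤ_ 0ℤ

sumℤ-++ : ∀ xs ys → sumℤ (xs ++ ys) ≡ sumℤ xs +ℤ sumℤ ys
sumℤ-++ []       ys = sym (ℤP.+-identityˡ _)
sumℤ-++ (x ∷ xs) ys = trans (cong (x +ℤ_) (sumℤ-++ xs ys)) (sym (ℤP.+-assoc x _ _))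

sumℤ-map-cong : ∀ {A : Set} {F G : A → ℤ} → (∀ x → F x ≡ G x) → ∀ xs → sumℤ (map F xs) ≡ sumℤ (map G xs)
sumℤ-map-cong F≗G []       = refl
sumℤ-map-cong F≗G (x ∷ xs) = cong₂ _+ℤ_ (F≗G x) (sumℤ-map-cong F≗G xs)

sumℤ-map-concatMap : ∀ {A B : Set} (H : B → ℤ) (K : A → List B) xs →
  sumℤ (map H (concatMap K xs)) ≡ sumℤ (map (λ a → sumℤ (map H (K a))) xs)
sumℤ-map-concatMap H K []       = refl
sumℤ-map-concatMap H K (a ∷ xs) =
  trans (cong sumℤ (map-++ H (K a) (concatMap K xs)))
        (trans (sumℤ-++ (map H (K a)) _) (cong (sumℤ (map H (K a)) +ℤ_) (sumℤ-map-concatMap H K xs)))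

sumℤ-map-tabulate : ∀ {A : Set} {n} (F : A → ℤ) (f : Fin n → A) → sumℤ (map F (tabulate f)) ≡ ℤΣ.sum (F ∘ f)
sumℤ-map-tabulate {n = zero}  F f = refl
sumℤ-map-tabulate {n = suc n} F f = cong (F (f zero) +ℤ_) (sumℤ-map-tabulate F (f ∘ suc))

sumℤ-map-+ : ∀ {A : Set} (F G : A → ℤ) xs → sumℤ (map (λ x → F x +ℤ G x) xs) ≡ sumℤ (map F xs) +ℤ sumℤ (map G xs)
sumℤ-map-+ F G []       = refl
sumℤ-map-+ F G (x ∷ xs) = trans (cong (F x +ℤ G x +ℤ_) (sumℤ-map-+ F G xs)) (interchange (F x) (G x) _ _)

sumℤ-map-neg : ∀ {A : Set} (F : A → ℤ) xs → sumℤ (map (λ x → ℤ.- F x) xs) ≡ ℤ.- sumℤ (map F xs)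
sumℤ-map-neg F []       = refl
sumℤ-map-neg F (x ∷ xs) = trans (cong (ℤ.- F x +ℤ_) (sumℤ-map-neg F xs)) (sym (ℤP.neg-distrib-+ (F x) _))

sumℤ-map-0 : ∀ {A : Set} (xs : List A) → sumℤ (map (λ _ → 0ℤ) xs) ≡ 0ℤ
sumℤ-map-0 []       = refl
sumℤ-map-0 (x ∷ xs) = trans (ℤP.+-identityˡ _) (sumℤ-map-0 xs)

sumℤ-map-filter : ∀ {A : Set} {P : A → Set} (P? : ∀ x → Dec (P x)) (h : A → ℤ) xs →
  sumℤ (map h (filter P? xs)) ≡ sumℤ (map (λ x → if does (P? x) then h x else 0ℤ) xs)
sumℤ-map-filter P? h []       = refl
sumℤ-map-filter P? h (x ∷ xs) with P? x
... | yes _ = cong (h x +ℤ_) (sumℤ-map-filter P? h xs)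
... | no  _ = trans (sumℤ-map-filter P? h xs) (sym (ℤP.+-identityˡ _))

Extensional : ∀ {n m} → ((Fin n → Fin m) → ℤ) → Set
Extensional H = ∀ {f g} → (∀ i → f i ≡ g i) → H f ≡ H g

sumℤ-allFuns-suc : ∀ n m (H : (Fin (suc n) → Fin m) → ℤ) → Extensional H →
  sumℤ (map H (allFuns (suc n) m)) ≡ sumℤ (map (λ f → ℤΣ.sum (λ x → H (x ∷ᶠ f))) (allFuns n m))
sumℤ-allFuns-suc n m H H-ext =
  trans (sumℤ-map-concatMap H _ (allFuns n m))
        (sumℤ-map-cong (λ f → extensions f _ λ x → λ { zero → refl ; (suc i) → refl }) (allFuns n m))
  where
  extensions : ∀ f (g : Fin m → Fin (suc n) → Fin m) → (∀ x i → g x i ≡ (x ∷ᶠ f) i) →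
    sumℤ (map H (map g (allFin m))) ≡ ℤΣ.sum (λ x → H (x ∷ᶠ f))
  extensions f g g≗ =
    trans (cong sumℤ (sym (map-∘ (allFin m))))
          (trans (sumℤ-map-tabulate (H ∘ g) id) (ℤΣ.sum-cong-≗ λ x → H-ext (g≗ x)))

sumℤ-allFuns-permute : ∀ n m (ρ : Permutation m m) (H : (Fin n → Fin m) → ℤ) → Extensional H →
  sumℤ (map H (allFuns n m)) ≡ sumℤ (map (λ f → H ((ρ ⟨$⟩ʳ_) ∘ f)) (allFuns n m))
sumℤ-allFuns-permute zero    m ρ H H-ext = cong (ℤ._+ 0ℤ) (H-ext λ ())
sumℤ-allFuns-permute (suc n) m ρ H H-ext = begin
    sumℤ (map H (allFuns (suc n) m))
  ≡⟨ sumℤ-allFuns-suc n m H H-ext ⟩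
    sumℤ (map (λ f → ℤΣ.sum (λ x → H (x ∷ᶠ f))) (allFuns n m))
  ≡⟨ sumℤ-allFuns-permute n m ρ _ (λ f≗g → ℤΣ.sum-cong-≗ λ x → H-ext (∷-cong x f≗g)) ⟩
    sumℤ (map (λ f → ℤΣ.sum (λ x → H (x ∷ᶠ ρ∘ f))) (allFuns n m))
  ≡⟨ sumℤ-map-cong (λ f → ℤΣ.∑-permute (λ x → H (x ∷ᶠ ρ∘ f)) ρ) (allFuns n m) ⟩
    sumℤ (map (λ f → ℤΣ.sum (λ x → H ((ρ ⟨$⟩ʳ x) ∷ᶠ ρ∘ f))) (allFuns n m))
  ≡⟨ sumℤ-map-cong (λ f → ℤΣ.sum-cong-≗ λ x → H-ext (ρ∘-∷ x f)) (allFuns n m) ⟩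
    sumℤ (map (λ f → ℤΣ.sum (λ x → H (ρ∘ (x ∷ᶠ f)))) (allFuns n m))
  ≡⟨ sumℤ-allFuns-suc n m (H ∘ ρ∘_) (λ f≗g → H-ext (cong (ρ ⟨$⟩ʳ_) ∘ f≗g)) ⟨
    sumℤ (map (λ f → H (ρ∘ f)) (allFuns (suc n) m)) ∎
  where
  open ≡-Reasoning
  ρ∘_ : ∀ {k} → (Fin k → Fin m) → Fin k → Fin m
  ρ∘ f = (ρ ⟨$⟩ʳ_) ∘ f
  ∷-cong : ∀ x {f g : Fin n → Fin m} → (∀ i → f i ≡ g i) → ∀ i → (x ∷ᶠ f) i ≡ (x ∷ᶠ g) i
  ∷-cong x f≗g zero    = refl
  ∷-cong x f≗g (suc i) = f≗g i
  ρ∘-∷ : ∀ x (f : Fin n → Fin m) i → ((ρ ⟨$⟩ʳ x) ∷ᶠ ρ∘ f) i ≡ (ρ∘ (x ∷ᶠ f)) i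
  ρ∘-∷ x f zero    = refl
  ρ∘-∷ x f (suc i) = refl

sumℤ-allFuns-signReversing : ∀ n m (ρ : Permutation m m) (H : (Fin n → Fin m) → ℤ) → Extensional H →
  (∀ f → H ((ρ ⟨$⟩ʳ_) ∘ f) ≡ ℤ.- H f) → sumℤ (map H (allFuns n m)) ≡ 0ℤ
sumℤ-allFuns-signReversing n m ρ H H-ext H-neg =
  self-negating (trans (sumℤ-allFuns-permute n m ρ H H-ext)
                       (trans (sumℤ-map-cong H-neg (allFuns n m)) (sumℤ-map-neg H (allFuns n m))))
  where
  self-negating : ∀ {x} → x ≡ ℤ.- x → x ≡ 0ℤ
  self-negating {ℤ.+ zero}    _ = refl
  self-negating {ℤ.+ (suc _)} ()
  self-negating {ℤ.-[1+ _ ]}  ()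

module _ {n : ℕ} (i j : Fin n) where

  transpose-ˡ : PC.transpose i j i ≡ j
  transpose-ˡ rewrite dec-true (i ≟ᶠ i) refl = refl

  transpose-ʳ : PC.transpose i j j ≡ i
  transpose-ʳ with j ≟ᶠ i
  ... | yes refl = refl
  ... | no _ rewrite dec-true (j ≟ᶠ j) refl = refl

  transpose-other : ∀ {k} → k ≢ i → k ≢ j → PC.transpose i j k ≡ k
  transpose-other {k} k≢i k≢j rewrite dec-false (k ≟ᶠ i) k≢i | dec-false (k ≟ᶠ j) k≢j = refl

  transpose-involutive : ∀ k → PC.transpose i j (PC.transpose i j k) ≡ k
  transpose-involutive k = by-cases (k ≟ᶠ i) (k ≟ᶠ j)
    where
    τ : Fin n → Fin n
    τ = PC.transpose i j
    by-cases : Dec (k ≡ i) → Dec (k ≡ j) → τ (τ k) ≡ k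
    by-cases (yes k≡i) _         = trans (cong (τ ∘ τ) k≡i) (trans (cong τ transpose-ˡ) (trans transpose-ʳ (sym k≡i)))
    by-cases (no _)    (yes k≡j) = trans (cong (τ ∘ τ) k≡j) (trans (cong τ transpose-ʳ) (trans transpose-ˡ (sym k≡j)))
    by-cases (no k≢i)  (no k≢j)  = trans (cong τ (transpose-other k≢i k≢j)) (transpose-other k≢i k≢j)

-- Swapping two adjacent values changes the relative order of no other pair of values.
module _ {n : ℕ} (a b : Fin n) (b≡1+a : toℕ b ≡ suc (toℕ a)) where

  private
    τ : Fin n → Fin n
    τ = PC.transpose a b

  data Place (t : Fin n) : Set where
    at-a  : t ≡ a → Place t
    at-b  : t ≡ b → Place t
    other : t ≢ a → t ≢ b → Place t

  place : ∀ t → Place t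
  place t with t ≟ᶠ a | t ≟ᶠ b
  ... | yes t≡a | _       = at-a t≡a
  ... | no t≢a  | yes t≡b = at-b t≡b
  ... | no t≢a  | no t≢b  = other t≢a t≢b

  transpose-adjacent-<ᵇ : ∀ x y → ¬ (x ≡ a × y ≡ b) → ¬ (x ≡ b × y ≡ a) →
    (toℕ (τ y) <ᵇ toℕ (τ x)) ≡ (toℕ y <ᵇ toℕ x)
  transpose-adjacent-<ᵇ x y ¬ab ¬ba with place x | place y
  ... | at-a refl     | at-a refl = trans (<ᵇ-irrefl (toℕ (τ a))) (sym (<ᵇ-irrefl (toℕ a)))
  ... | at-a refl     | at-b refl = ⊥-elim (¬ab (refl , refl))
  ... | at-b refl     | at-a refl = ⊥-elim (¬ba (refl , refl))
  ... | at-b refl     | at-b refl = trans (<ᵇ-irrefl (toℕ (τ b))) (sym (<ᵇ-irrefl (toℕ b)))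
  ... | at-a refl     | other y≢a y≢b
    rewrite transpose-ˡ a b | transpose-other a b y≢a y≢b | b≡1+a = <ᵇ-suc (y≢a ∘ toℕ-injective)
  ... | at-b refl     | other y≢a y≢b
    rewrite transpose-ʳ a b | transpose-other a b y≢a y≢b | b≡1+a = sym (<ᵇ-suc (y≢a ∘ toℕ-injective))
  ... | other x≢a x≢b | at-a refl
    rewrite transpose-ˡ a b | transpose-other a b x≢a x≢b | b≡1+a =
      suc-<ᵇ λ x≡1+a → x≢b (toℕ-injective (trans x≡1+a (sym b≡1+a)))
  ... | other x≢a x≢b | at-b refl
    rewrite transpose-ʳ a b | transpose-other a b x≢a x≢b | b≡1+a =
      sym (suc-<ᵇ λ x≡1+a → x≢b (toℕ-injective (trans x≡1+a (sym b≡1+a))))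
  ... | other x≢a x≢b | other y≢a y≢b
    rewrite transpose-other a b x≢a x≢b | transpose-other a b y≢a y≢b = refl

infixl 6 _∖_

_∖_ : ∀ {n} → (Fin n → Fin n → Bool) → Fin n × Fin n → Fin n → Fin n → Bool
(p ∖ (x , y)) u v = p u v ∧ not (⌊ u ≟ᶠ x ⌋ ∧ ⌊ v ≟ᶠ y ⌋)

∖-removed : ∀ {n} (p : Fin n → Fin n → Bool) (x y : Fin n) → (p ∖ (x , y)) x y ≡ false
∖-removed p x y with x ≟ᶠ x | y ≟ᶠ y
... | yes _ | yes _ = ∧-zeroʳ (p x y)
... | no x≢x | _     = ⊥-elim (x≢x refl)
... | yes _ | no y≢y = ⊥-elim (y≢y refl)

∖-kept : ∀ {n} (p : Fin n → Fin n → Bool) {x y u v : Fin n} → ¬ (u ≡ x × v ≡ y) → (p ∖ (x , y)) u v ≡ p u v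
∖-kept p {x} {y} {u} {v} ¬uv with u ≟ᶠ x | v ≟ᶠ y
... | yes u≡x | yes v≡y = ⊥-elim (¬uv (u≡x , v≡y))
... | yes _   | no _    = ∧-identityʳ (p u v)
... | no _    | _       = ∧-identityʳ (p u v)

countPairs-remove : ∀ n (p : Fin n → Fin n → Bool) (x y : Fin n) →
  countPairs n p ≡ countPairs n (p ∖ (x , y)) + 𝟙 (p x y)
countPairs-remove n p x y = begin
    countPairs n p
  ≡⟨ countPairs≡∑∑ n p ⟩
    sum (λ u → sum (λ v → 𝟙 (p u v)))
  ≡⟨ sum-cong-≗ (λ u → trans (sum-cong-≗ λ v → 𝟙-split (p u v) ⌊ u ≟ᶠ x ⌋ ⌊ v ≟ᶠ y ⌋)
                                (∑-distrib-+ {n} _ _)) ⟩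
    sum (λ u → sum (λ v → 𝟙 ((p ∖ (x , y)) u v)) + sum (λ v → cell u v))
  ≡⟨ ∑-distrib-+ {n} _ _ ⟩
    sum (λ u → sum (λ v → 𝟙 ((p ∖ (x , y)) u v))) + sum (λ u → sum (λ v → cell u v))
  ≡⟨ cong₂ _+_ (sym (countPairs≡∑∑ n (p ∖ (x , y)))) (trans (sum-cong-≗ row) (sum-at x _)) ⟩
    countPairs n (p ∖ (x , y)) + sum (λ v → if ⌊ v ≟ᶠ y ⌋ then 𝟙 (p x v) else 0)
  ≡⟨ cong (countPairs n (p ∖ (x , y)) +_) (sum-at y (λ v → 𝟙 (p x v))) ⟩
    countPairs n (p ∖ (x , y)) + 𝟙 (p x y) ∎
  where
  open ≡-Reasoning
  cell : Fin n → Fin n → ℕ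
  cell u v = if ⌊ u ≟ᶠ x ⌋ then (if ⌊ v ≟ᶠ y ⌋ then 𝟙 (p u v) else 0) else 0
  𝟙-split : ∀ a b c → 𝟙 a ≡ 𝟙 (a ∧ not (b ∧ c)) + (if b then (if c then 𝟙 a else 0) else 0)
  𝟙-split true  true  true  = refl
  𝟙-split true  true  false = refl
  𝟙-split true  false c     = refl
  𝟙-split false true  true  = refl
  𝟙-split false true  false = refl
  𝟙-split false false c     = refl
  row : ∀ u → sum (λ v → cell u v)
            ≡ (if ⌊ u ≟ᶠ x ⌋ then sum (λ v → if ⌊ v ≟ᶠ y ⌋ then 𝟙 (p u v) else 0) else 0)
  row u with ⌊ u ≟ᶠ x ⌋
  ... | true  = refl
  ... | false = sum-replicate-zero n

countPairs-remove-pair : ∀ n (p : Fin n → Fin n → Bool) {x y : Fin n} → x ≢ y →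
  countPairs n p ≡ countPairs n (p ∖ (x , y) ∖ (y , x)) + (𝟙 (p x y) + 𝟙 (p y x))
countPairs-remove-pair n p {x} {y} x≢y = begin
    countPairs n p
  ≡⟨ countPairs-remove n p x y ⟩
    countPairs n (p ∖ (x , y)) + 𝟙 (p x y)
  ≡⟨ cong (_+ 𝟙 (p x y)) (countPairs-remove n (p ∖ (x , y)) y x) ⟩
    countPairs n (p ∖ (x , y) ∖ (y , x)) + 𝟙 ((p ∖ (x , y)) y x) + 𝟙 (p x y)
  ≡⟨ cong (λ b → countPairs n (p ∖ (x , y) ∖ (y , x)) + 𝟙 b + 𝟙 (p x y)) (∖-kept p (x≢y ∘ sym ∘ proj₁)) ⟩
    countPairs n (p ∖ (x , y) ∖ (y , x)) + 𝟙 (p y x) + 𝟙 (p x y)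
  ≡⟨ +-assoc (countPairs n (p ∖ (x , y) ∖ (y , x))) _ _ ⟩
    countPairs n (p ∖ (x , y) ∖ (y , x)) + (𝟙 (p y x) + 𝟙 (p x y))
  ≡⟨ cong (countPairs n (p ∖ (x , y) ∖ (y , x)) +_) (+-comm (𝟙 (p y x)) _) ⟩
    countPairs n (p ∖ (x , y) ∖ (y , x)) + (𝟙 (p x y) + 𝟙 (p y x)) ∎
  where open ≡-Reasoning

countPairs-cong : ∀ n {p q : Fin n → Fin n → Bool} → (∀ u v → p u v ≡ q u v) → countPairs n p ≡ countPairs n q
countPairs-cong n p≗q =
  trans (countPairs≡∑∑ n _)
        (trans (sum-cong-≗ λ u → sum-cong-≗ λ v → cong 𝟙 (p≗q u v)) (sym (countPairs≡∑∑ n _)))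

∖-pair-cong : ∀ {n} {p q : Fin n → Fin n → Bool} {x y : Fin n} → x ≢ y →
  (∀ u v → ¬ (u ≡ x × v ≡ y) → ¬ (u ≡ y × v ≡ x) → p u v ≡ q u v) →
  ∀ u v → (p ∖ (x , y) ∖ (y , x)) u v ≡ (q ∖ (x , y) ∖ (y , x)) u v
∖-pair-cong {p = p} {q} {x} {y} x≢y agree u v with (u ≟ᶠ x) ×-dec (v ≟ᶠ y) | (u ≟ᶠ y) ×-dec (v ≟ᶠ x)
... | yes (refl , refl) | _ =
  trans (∖-kept (p ∖ (x , y)) (x≢y ∘ proj₁)) (trans (∖-removed p x y)
    (sym (trans (∖-kept (q ∖ (x , y)) (x≢y ∘ proj₁)) (∖-removed q x y))))
... | no _ | yes (refl , refl) = trans (∖-removed (p ∖ (x , y)) y x) (sym (∖-removed (q ∖ (x , y)) y x))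
... | no ¬xy | no ¬yx =
  trans (∖-kept (p ∖ (x , y)) ¬yx) (trans (∖-kept p ¬xy)
    (trans (agree u v ¬xy ¬yx) (sym (trans (∖-kept (q ∖ (x , y)) ¬yx) (∖-kept q ¬xy)))))

descents : ∀ {n} → (Fin n → Fin n → Bool) → (Fin n → Fin n) → Fin n → Fin n → Bool
descents D σ u v = D u v ∧ (toℕ (σ v) <ᵇ toℕ (σ u))

module _ {n : ℕ} (D : Fin n → Fin n → Bool) (a b : Fin n) (b≡1+a : toℕ b ≡ suc (toℕ a)) where

  private
    τ : Fin n → Fin n
    τ = PC.transpose a b

  descents-increasing : ∀ ρ {x y} → ρ x ≡ a → ρ y ≡ b → descents D ρ x y ≡ false × descents D ρ y x ≡ D y x
  descents-increasing ρ {x} {y} ρx≡a ρy≡b =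
    trans (cong₂ (λ s t → D x y ∧ (toℕ t <ᵇ toℕ s)) ρx≡a ρy≡b)
          (trans (cong (D x y ∧_) (≤⇒<ᵇ≡false (<⇒≤ a<b))) (∧-zeroʳ _)) ,
    trans (cong₂ (λ s t → D y x ∧ (toℕ s <ᵇ toℕ t)) ρx≡a ρy≡b)
          (trans (cong (D y x ∧_) (<⇒<ᵇ≡true a<b)) (∧-identityʳ _))
    where
    a<b : toℕ a < toℕ b
    a<b = ≤-reflexive (sym b≡1+a)

  module _ {σ : Fin n → Fin n} (inj : Injective σ) {u₀ v₀ : Fin n} (σu₀≡a : σ u₀ ≡ a) (σv₀≡b : σ v₀ ≡ b)
    where

    u₀≢v₀ : u₀ ≢ v₀
    u₀≢v₀ u₀≡v₀ =
      1+n≢n (trans (sym b≡1+a) (cong toℕ (trans (sym σv₀≡b) (trans (cong σ (sym u₀≡v₀)) σu₀≡a))))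

    descents-transpose-elsewhere : ∀ u v → ¬ (u ≡ u₀ × v ≡ v₀) → ¬ (u ≡ v₀ × v ≡ u₀) →
      descents D σ u v ≡ descents D (τ ∘ σ) u v
    descents-transpose-elsewhere u v ¬u₀v₀ ¬v₀u₀ = cong (D u v ∧_) (sym (transpose-adjacent-<ᵇ a b b≡1+a (σ u) (σ v)
      (λ (σu≡a , σv≡b) → ¬u₀v₀ (inj u u₀ (trans σu≡a (sym σu₀≡a)) , inj v v₀ (trans σv≡b (sym σv₀≡b))))
      (λ (σu≡b , σv≡a) → ¬v₀u₀ (inj u v₀ (trans σu≡b (sym σv₀≡b)) , inj v u₀ (trans σv≡a (sym σu₀≡a))))))

    descentsOffPair : ℕ
    descentsOffPair = countPairs n (descents D σ ∖ (u₀ , v₀) ∖ (v₀ , u₀))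

    des≡ : des D σ ≡ descentsOffPair + 𝟙 (D v₀ u₀)
    des≡ = trans (countPairs-remove-pair n (descents D σ) u₀≢v₀)
      (cong₂ (λ c d → descentsOffPair + (𝟙 c + 𝟙 d))
             (proj₁ (descents-increasing σ σu₀≡a σv₀≡b)) (proj₂ (descents-increasing σ σu₀≡a σv₀≡b)))

    des-transpose≡ : des D (τ ∘ σ) ≡ descentsOffPair + 𝟙 (D u₀ v₀)
    des-transpose≡ = begin
        des D (τ ∘ σ)
      ≡⟨ countPairs-remove-pair n (descents D (τ ∘ σ)) u₀≢v₀ ⟩
        countPairs n (descents D (τ ∘ σ) ∖ (u₀ , v₀) ∖ (v₀ , u₀))
          + (𝟙 (descents D (τ ∘ σ) u₀ v₀) + 𝟙 (descents D (τ ∘ σ) v₀ u₀))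
      ≡⟨ cong (_+ (𝟙 (descents D (τ ∘ σ) u₀ v₀) + 𝟙 (descents D (τ ∘ σ) v₀ u₀)))
              (sym (countPairs-cong n (∖-pair-cong u₀≢v₀ descents-transpose-elsewhere))) ⟩
        descentsOffPair + (𝟙 (descents D (τ ∘ σ) u₀ v₀) + 𝟙 (descents D (τ ∘ σ) v₀ u₀))
      ≡⟨ cong₂ (λ c d → descentsOffPair + (𝟙 c + 𝟙 d)) (proj₂ τσ-increasing) (proj₁ τσ-increasing) ⟩
        descentsOffPair + (𝟙 (D u₀ v₀) + 0)
      ≡⟨ cong (descentsOffPair +_) (+-identityʳ _) ⟩
        descentsOffPair + 𝟙 (D u₀ v₀) ∎
      where
      open ≡-Reasoning
      τσ-increasing : descents D (τ ∘ σ) v₀ u₀ ≡ false × descents D (τ ∘ σ) u₀ v₀ ≡ D u₀ v₀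
      τσ-increasing = descents-increasing (τ ∘ σ)
        (trans (cong τ σv₀≡b) (transpose-ʳ a b)) (trans (cong τ σu₀≡a) (transpose-ˡ a b))

    -- The transposition reverses exactly one relative order along an edge: that of the arc between u₀ and v₀.
    des-transpose-adjacent : (D u₀ v₀ xor D v₀ u₀) ≡ true → parity (des D (τ ∘ σ)) ≡ not (parity (des D σ))
    des-transpose-adjacent arc = begin
        parity (des D (τ ∘ σ))
      ≡⟨ cong parity des-transpose≡ ⟩
        parity (descentsOffPair + 𝟙 (D u₀ v₀))
      ≡⟨ parity-+-𝟙 descentsOffPair (D u₀ v₀) ⟩
        parity descentsOffPair xor D u₀ v₀
      ≡⟨ cong (parity descentsOffPair xor_) (xor≡true⇒≡not (D u₀ v₀) (D v₀ u₀) arc) ⟩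
        parity descentsOffPair xor not (D v₀ u₀)
      ≡⟨ not-distribʳ-xor (parity descentsOffPair) (D v₀ u₀) ⟨
        not (parity descentsOffPair xor D v₀ u₀)
      ≡⟨ cong not (parity-+-𝟙 descentsOffPair (D v₀ u₀)) ⟨
        not (parity (descentsOffPair + 𝟙 (D v₀ u₀)))
      ≡⟨ cong (not ∘ parity) des≡ ⟨
        not (parity (des D σ)) ∎
      where
      open ≡-Reasoning
      xor≡true⇒≡not : ∀ x y → (x xor y) ≡ true → x ≡ not y
      xor≡true⇒≡not true  false _ = refl
      xor≡true⇒≡not false true  _ = refl

-- Weighting non-bijections by 0 lets the relabelling involution act on the list allFuns n n.
sign : ∀ {n} → (Fin n → Fin n → Bool) → (Fin n → Fin n) → ℤ
sign D σ = if does (bijective? σ) then -1ℤ ^ des D σ else 0ℤ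

A-at-minus1≡sumℤ-sign : ∀ {n} (D : Fin n → Fin n → Bool) → A-at-minus1 D ≡ sumℤ (map (sign D) (allFuns n n))
A-at-minus1≡sumℤ-sign {n} D = sumℤ-map-filter bijective? (λ σ → -1ℤ ^ des D σ) (allFuns n n)

sign-nonbijective : ∀ {n} (D : Fin n → Fin n → Bool) {σ : Fin n → Fin n} → ¬ Bijective σ → sign D σ ≡ 0ℤ
sign-nonbijective D {σ} ¬bij = cong (if_then -1ℤ ^ des D σ else 0ℤ) (dec-false (bijective? σ) ¬bij)

bijective-cong : ∀ {n} {σ σ′ : Fin n → Fin n} → (∀ i → σ i ≡ σ′ i) → Bijective σ → Bijective σ′
bijective-cong σ≗σ′ (inj , surj) =
  (λ u v eq → inj u v (trans (σ≗σ′ u) (trans eq (sym (σ≗σ′ v))))) ,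
  (λ y → proj₁ (surj y) , trans (sym (σ≗σ′ _)) (proj₂ (surj y)))

bijective-involution-∘ : ∀ {n} {τ : Fin n → Fin n} → (∀ x → τ (τ x) ≡ x) →
  ∀ {σ : Fin n → Fin n} → Bijective σ → Bijective (τ ∘ σ)
bijective-involution-∘ {τ = τ} τ-involutive (inj , surj) =
  (λ u v eq → inj u v (trans (sym (τ-involutive _)) (trans (cong τ eq) (τ-involutive _)))) ,
  (λ y → proj₁ (surj (τ y)) , trans (cong τ (proj₂ (surj (τ y)))) (τ-involutive y))

sign-extensional : ∀ {n} (D : Fin n → Fin n → Bool) → Extensional (sign D)
sign-extensional {n} D {σ} {σ′} σ≗σ′ = cong₂ (λ b d → if b then -1ℤ ^ d else 0ℤ)
  (does-⇔ (mk⇔ (bijective-cong σ≗σ′) (bijective-cong (sym ∘ σ≗σ′))) (bijective? σ) (bijective? σ′))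
  (countPairs-cong n λ u v → cong₂ (λ s t → D u v ∧ (toℕ t <ᵇ toℕ s)) (σ≗σ′ u) (σ≗σ′ v))

-1^-parity : ∀ m → -1ℤ ^ m ≡ (if parity m then -1ℤ else 1ℤ)
-1^-parity zero = refl
-1^-parity (suc m) rewrite -1^-parity m with parity m
... | true  = refl
... | false = refl

-1^-flip : ∀ m m′ → parity m′ ≡ not (parity m) → -1ℤ ^ m′ ≡ ℤ.- (-1ℤ ^ m)
-1^-flip m m′ flip rewrite -1^-parity m | -1^-parity m′ | flip with parity m
... | true  = refl
... | false = refl

module _ {n r : ℕ} (part : Fin n → Fin r) where

  SplitAt : ℕ → (Fin n → Fin n) → Set
  SplitAt k σ = ∃ λ u → ∃ λ v → toℕ (σ u) ≡ k + k × toℕ (σ v) ≡ suc (k + k) × part u ≢ part v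

  splitAt? : ∀ k σ → Dec (SplitAt k σ)
  splitAt? k σ = any? λ u → any? λ v →
    (toℕ (σ u) ≟ℕ k + k) ×-dec (toℕ (σ v) ≟ℕ suc (k + k)) ×-dec ¬? (part u ≟ᶠ part v)

  splits : ℕ → (Fin n → Fin n) → Bool
  splits k σ = does (splitAt? k σ)

  unsplitBelow : ℕ → (Fin n → Fin n) → Bool
  unsplitBelow zero    σ = true
  unsplitBelow (suc k) σ = unsplitBelow k σ ∧ not (splits k σ)

  splitAt-cong : ∀ {k} {σ σ′ : Fin n → Fin n} → (∀ i → σ i ≡ σ′ i) → SplitAt k σ → SplitAt k σ′
  splitAt-cong σ≗σ′ (u , v , σu≡2k , σv≡2k+1 , u≁v) =
    u , v , trans (cong toℕ (sym (σ≗σ′ u))) σu≡2k , trans (cong toℕ (sym (σ≗σ′ v))) σv≡2k+1 , u≁v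

  splits-cong : ∀ k {σ σ′ : Fin n → Fin n} → (∀ i → σ i ≡ σ′ i) → splits k σ ≡ splits k σ′
  splits-cong k σ≗σ′ =
    does-⇔ (mk⇔ (splitAt-cong {k} σ≗σ′) (splitAt-cong {k} (sym ∘ σ≗σ′))) (splitAt? k _) (splitAt? k _)

  unsplitBelow-cong : ∀ k {σ σ′ : Fin n → Fin n} → (∀ i → σ i ≡ σ′ i) → unsplitBelow k σ ≡ unsplitBelow k σ′
  unsplitBelow-cong zero    σ≗σ′ = refl
  unsplitBelow-cong (suc k) σ≗σ′ = cong₂ (λ u s → u ∧ not s) (unsplitBelow-cong k σ≗σ′) (splits-cong k σ≗σ′)

  unsplitBelow⇒¬SplitAt : ∀ j {σ} → unsplitBelow j σ ≡ true → ∀ k → k < j → ¬ SplitAt k σ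
  unsplitBelow⇒¬SplitAt (suc j) {σ} unsplit k (s≤s k≤j) split with m≤n⇒m<n∨m≡n k≤j
  ... | inj₁ k<j  = unsplitBelow⇒¬SplitAt j (∧-conicalˡ _ _ unsplit) k k<j split
  ... | inj₂ refl =
    contradiction (trans (sym (cong not (dec-true (splitAt? k σ) split))) (∧-conicalʳ _ _ unsplit)) λ ()

  unsplit⇒paired : ∀ {σ} → unsplitBelow n σ ≡ true → (bij : Bijective σ) → Paired (part ∘ inverse bij)
  unsplit⇒paired unsplit bij k a b a≡2k b≡2k+1 with part (inverse bij a) ≟ᶠ part (inverse bij b)
  ... | yes same = same
  ... | no different = ⊥-elim (unsplitBelow⇒¬SplitAt n unsplit k k<n
          (inverse bij a , inverse bij b , trans (cong toℕ (inverseʳ bij a)) a≡2k ,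
           trans (cong toℕ (inverseʳ bij b)) b≡2k+1 , different))
    where
    k<n : k < n
    k<n = ≤-<-trans (m≤m+n k k) (subst (_< n) a≡2k (toℕ<n a))

  module _ (D : Fin n → Fin n → Bool) (orientation : IsOrientation (completeMultipartite part) D) where

    firstSplitTerm : ℕ → (Fin n → Fin n) → ℤ
    firstSplitTerm k σ = if unsplitBelow k σ ∧ splits k σ then sign D σ else 0ℤ

    firstSplitTerm-extensional : ∀ k → Extensional (firstSplitTerm k)
    firstSplitTerm-extensional k σ≗σ′ = cong₂ (λ b z → if b then z else 0ℤ)
      (cong₂ _∧_ (unsplitBelow-cong k σ≗σ′) (splits-cong k σ≗σ′)) (sign-extensional D σ≗σ′)

    module _ (k : ℕ) (2k+1<n : suc (k + k) < n) where

      private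
        a b : Fin n
        a = fromℕ< (<⇒≤ 2k+1<n)
        b = fromℕ< 2k+1<n
        a≡2k : toℕ a ≡ k + k
        a≡2k = toℕ-fromℕ< (<⇒≤ 2k+1<n)
        b≡2k+1 : toℕ b ≡ suc (k + k)
        b≡2k+1 = toℕ-fromℕ< 2k+1<n
        b≡1+a : toℕ b ≡ suc (toℕ a)
        b≡1+a = trans b≡2k+1 (cong suc (sym a≡2k))
        τ : Fin n → Fin n
        τ = PC.transpose a b
        τ-involutive : ∀ t → τ (τ t) ≡ t
        τ-involutive = transpose-involutive a b

      transpose-fixes-below : ∀ t → toℕ t < k + k → τ t ≡ t
      transpose-fixes-below t t<2k = transpose-other a b
        (λ t≡a → <-irrefl (trans (cong toℕ t≡a) a≡2k) t<2k)
        (λ t≡b → <-irrefl (trans (cong toℕ t≡b) b≡2k+1) (m<n⇒m<1+n t<2k))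

      splitAt-transpose : ∀ {j σ} → j ≤ k → SplitAt j σ → SplitAt j (τ ∘ σ)
      splitAt-transpose {j} {σ} j≤k (u , v , σu≡2j , σv≡2j+1 , u≁v) with m≤n⇒m<n∨m≡n j≤k
      ... | inj₁ j<k = u , v ,
        trans (cong toℕ (transpose-fixes-below (σ u) (subst (_< k + k) (sym σu≡2j) (<-trans (n<1+n (j + j)) 2j+1<2k)))) σu≡2j ,
        trans (cong toℕ (transpose-fixes-below (σ v) (subst (_< k + k) (sym σv≡2j+1) 2j+1<2k))) σv≡2j+1 ,
        u≁v
        where
        2j+1<2k : suc (j + j) < k + k
        2j+1<2k = ≤-trans (s≤s (≤-reflexive (sym (+-suc j j)))) (+-mono-≤ j<k j<k)
      ... | inj₂ refl = v , u ,
        trans (cong toℕ (trans (cong τ (toℕ-injective (trans σv≡2j+1 (sym b≡2k+1)))) (transpose-ʳ a b))) a≡2k ,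
        trans (cong toℕ (trans (cong τ (toℕ-injective (trans σu≡2j (sym a≡2k)))) (transpose-ˡ a b))) b≡2k+1 ,
        u≁v ∘ sym

      splits-transpose : ∀ {j σ} → j ≤ k → splits j (τ ∘ σ) ≡ splits j σ
      splits-transpose {j} {σ} j≤k = does-⇔
        (mk⇔ (λ split → splitAt-cong {j} {τ ∘ (τ ∘ σ)} {σ} (τ-involutive ∘ σ)
                                      (splitAt-transpose {σ = τ ∘ σ} j≤k split))
             (splitAt-transpose {σ = σ} j≤k))
        (splitAt? j (τ ∘ σ)) (splitAt? j σ)

      unsplitBelow-transpose : ∀ j {σ} → j ≤ k → unsplitBelow j (τ ∘ σ) ≡ unsplitBelow j σ
      unsplitBelow-transpose zero    _    = refl
      unsplitBelow-transpose (suc j) j<k =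
        cong₂ (λ u s → u ∧ not s) (unsplitBelow-transpose j (<⇒≤ j<k)) (splits-transpose (<⇒≤ j<k))

      sign-transpose : ∀ {σ} → SplitAt k σ → sign D (τ ∘ σ) ≡ ℤ.- sign D σ
      sign-transpose {σ} (u₀ , v₀ , σu₀≡2k , σv₀≡2k+1 , u₀≁v₀) =
        trans (cong (if_then -1ℤ ^ des D (τ ∘ σ) else 0ℤ)
                    (does-⇔ (mk⇔ (λ bij → bijective-cong {σ = τ ∘ (τ ∘ σ)} {σ′ = σ} (τ-involutive ∘ σ)
                                             (bijective-involution-∘ {τ = τ} τ-involutive bij))
                                  (bijective-involution-∘ {τ = τ} τ-involutive))
                            (bijective? (τ ∘ σ)) (bijective? σ)))
              (flip (bijective? σ))
        where
        adjacent : completeMultipartite part u₀ v₀ ≡ true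
        adjacent with part u₀ ≟ᶠ part v₀
        ... | yes same = ⊥-elim (u₀≁v₀ same)
        ... | no _     = refl
        flip : (bij? : Dec (Bijective σ)) →
          (if does bij? then -1ℤ ^ des D (τ ∘ σ) else 0ℤ) ≡ ℤ.- (if does bij? then -1ℤ ^ des D σ else 0ℤ)
        flip (yes bij) = -1^-flip (des D σ) (des D (τ ∘ σ))
          (des-transpose-adjacent D a b b≡1+a (proj₁ bij)
            (toℕ-injective (trans σu₀≡2k (sym a≡2k))) (toℕ-injective (trans σv₀≡2k+1 (sym b≡2k+1)))
            (proj₂ (orientation u₀ v₀) adjacent))
        flip (no _) = refl

      firstSplitTerm-transpose : ∀ σ → firstSplitTerm k (τ ∘ σ) ≡ ℤ.- firstSplitTerm k σ
      firstSplitTerm-transpose σ =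
        trans (cong₂ (λ u s → if u ∧ s then sign D (τ ∘ σ) else 0ℤ)
                     (unsplitBelow-transpose k ≤-refl) (splits-transpose ≤-refl))
              (by-cases (unsplitBelow k σ) (splitAt? k σ))
        where
        by-cases : ∀ u (split? : Dec (SplitAt k σ)) →
          (if u ∧ does split? then sign D (τ ∘ σ) else 0ℤ) ≡ ℤ.- (if u ∧ does split? then sign D σ else 0ℤ)
        by-cases true  (yes split) = sign-transpose split
        by-cases false (yes _)     = refl
        by-cases true  (no _)      = refl
        by-cases false (no _)      = refl

    firstSplitSum≡0 : ∀ k → sumℤ (map (firstSplitTerm k) (allFuns n n)) ≡ 0ℤ
    firstSplitSum≡0 k with suc (k + k) <? n
    ... | yes 2k+1<n = sumℤ-allFuns-signReversing n n
      (Perm.transpose (fromℕ< (<⇒≤ 2k+1<n)) (fromℕ< 2k+1<n))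
      (firstSplitTerm k) (firstSplitTerm-extensional k) (firstSplitTerm-transpose k 2k+1<n)
    ... | no 2k+1≮n = trans (sumℤ-map-cong vanish (allFuns n n)) (sumℤ-map-0 (allFuns n n))
      where
      vanish : ∀ σ → firstSplitTerm k σ ≡ 0ℤ
      vanish σ = cong (if_then sign D σ else 0ℤ)
        (trans (cong (unsplitBelow k σ ∧_)
                     (dec-false (splitAt? k σ) λ (_ , v , _ , σv≡2k+1 , _) → 2k+1≮n (subst (_< n) σv≡2k+1 (toℕ<n (σ v)))))
               (∧-zeroʳ _))

    unsplitSum : ℕ → ℤ
    unsplitSum j = sumℤ (map (λ σ → if unsplitBelow j σ then sign D σ else 0ℤ) (allFuns n n))

    unsplitSum-suc : ∀ j → unsplitSum j ≡ unsplitSum (suc j)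
    unsplitSum-suc j = begin
        unsplitSum j
      ≡⟨ sumℤ-map-cong (λ σ → if-split (unsplitBelow j σ) (splits j σ) (sign D σ)) (allFuns n n) ⟩
        sumℤ (map (λ σ → firstSplitTerm j σ +ℤ (if unsplitBelow (suc j) σ then sign D σ else 0ℤ)) (allFuns n n))
      ≡⟨ sumℤ-map-+ (firstSplitTerm j) _ (allFuns n n) ⟩
        sumℤ (map (firstSplitTerm j) (allFuns n n)) +ℤ unsplitSum (suc j)
      ≡⟨ cong (_+ℤ unsplitSum (suc j)) (firstSplitSum≡0 j) ⟩
        0ℤ +ℤ unsplitSum (suc j)
      ≡⟨ ℤP.+-identityˡ _ ⟩
        unsplitSum (suc j) ∎
      where
      open ≡-Reasoning
      if-split : ∀ u s z → (if u then z else 0ℤ) ≡ (if u ∧ s then z else 0ℤ) +ℤ (if u ∧ not s then z else 0ℤ)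
      if-split true  true  z = sym (ℤP.+-identityʳ z)
      if-split true  false z = sym (ℤP.+-identityˡ z)
      if-split false s     z = refl

    unsplitSum-constant : ∀ j → unsplitSum 0 ≡ unsplitSum j
    unsplitSum-constant zero    = refl
    unsplitSum-constant (suc j) = trans (unsplitSum-constant j) (unsplitSum-suc j)

    unsplitSum-n≡0 : TwoOddParts part → unsplitSum n ≡ 0ℤ
    unsplitSum-n≡0 odd = trans (sumℤ-map-cong vanish (allFuns n n)) (sumℤ-map-0 (allFuns n n))
      where
      vanish : ∀ σ → (if unsplitBelow n σ then sign D σ else 0ℤ) ≡ 0ℤ
      vanish σ with unsplitBelow n σ in unsplit
      ... | false = refl
      ... | true  = sign-nonbijective D λ bij →
                      twoOddParts⇒¬paired part odd (inverse-bijective bij) (unsplit⇒paired unsplit bij)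

    ν≡0 : TwoOddParts part → ν D ≡ 0
    ν≡0 odd = cong ℤ.∣_∣ (begin
        A-at-minus1 D
      ≡⟨ A-at-minus1≡sumℤ-sign D ⟩
        unsplitSum 0
      ≡⟨ unsplitSum-constant n ⟩
        unsplitSum n
      ≡⟨ unsplitSum-n≡0 odd ⟩
        0ℤ ∎)
      where open ≡-Reasoning

lemma3p10 : (n r : ℕ) (part : Fin n → Fin r) →
    (∃ λ i → ∃ λ j → ¬ (i ≡ j) × (partSize part i % 2 ≡ 1) × (partSize part j % 2 ≡ 1)) →
    ((D : Fin n → Fin n → Bool) → IsOrientation (completeMultipartite part) D → ν D ≡ 0)
    × (η (completeMultipartite part) ≡ 0)
lemma3p10 n r part odd = (λ D orientation → ν≡0 part D orientation odd) , η≡0 part odd
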